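{- Let $r,k\in\mathbb{Z}$ with $r\geq 1$. For every integer $n\geq 1$, \[ \tilde{A}_{n}^{(r,k)}(x)=x\tilde{A}_{n-1}^{(r,k)}(x-1)+r\sum_{a=0}^{n-1}\frac{(-1)^{a+1}a!}{a+2}\binom{n-1}{a}\tilde{A}_{n-1-a}^{(r+1,k)}(x)+\frac{1}{n}\left(\tilde{A}_{n}^{(r+1,k-1)}(x)-\tilde{A}_{n}^{(r+1,k)}(x)\right). \]
   Context: For $k\in\mathbb{Z}$ let $\mathrm{Lif}_{k}(x)=\sum_{m=0}^{\infty}\frac{x^{m}}{m!(m+1)^{k}}$. For an integer $r\geq 0$ and $k\in\mathbb{Z}$, the polynomials $\tilde{A}_{n}^{(r,k)}(x)$ are defined by \[ \left(\frac{t}{(1+t)\log(1+t)}\right)^{r}\mathrm{Lif}_{k}\bigl(-\log(1+t)\bigr)(1+t)^{x}=\sum_{n=0}^{\infty}\tilde{A}_{n}^{(r,k)}(x)\frac{t^{n}}{n!}. \] -}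

module Defs where

open import Data.Nat as ℕ using (ℕ; zero; suc; _∸_; _!)
open import Data.Nat.Properties using (_!≢0)
open import Data.Integer as ℤ using (ℤ; +_; -[1+_])
open import Data.Rational using (ℚ; _/_; _+_; _*_; _-_; -_; 0ℚ; 1ℚ)
open import Data.List using (List; []; _∷_; zipWith; foldr; map; upTo)

-- Formal power series in t with rational coefficients: n ↦ coefficient of t^n.
Series : Set
Series = ℕ → ℚ

sgn : ℕ → ℚ
sgn zero    = 1ℚ
sgn (suc j) = - sgn j

Σ≤ : ℕ → (ℕ → ℚ) → ℚ
Σ≤ zero    f = f 0
Σ≤ (suc n) f = Σ≤ n f + f (suc n)

recipSuc : ℕ → ℚ
recipSuc d = + 1 / suc d

recipFact : ℕ → ℚ
recipFact m = + 1 / (m !)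
  where instance _ = m !≢0

ℕ→ℚ : ℕ → ℚ
ℕ→ℚ m = + m / 1

_⊛_ : Series → Series → Series
(f ⊛ g) n = Σ≤ n (λ i → f i * g (n ∸ i))

infixl 7 _⊛_

oneS : Series
oneS zero    = 1ℚ
oneS (suc _) = 0ℚ

powS : Series → ℕ → Series
powS f zero    = oneS
powS f (suc m) = f ⊛ powS f m

-- Multiplicative inverse of a series g with g 0 = 1:
-- h 0 = 1,  h n = - Σ_{i=1}^{n} g i * h (n - i)  for n ≥ 1.
-- invList g n = [h n, h (n-1), ..., h 0].
invList : Series → ℕ → List ℚ
invList g zero    = 1ℚ ∷ []
invList g (suc n) = c ∷ prev
  where
    prev = invList g n
    c = - foldr _+_ 0ℚ (zipWith _*_ (map (λ i → g (suc i)) (upTo (suc n))) prev)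

invS : Series → Series
invS g n with invList g n
... | []    = 0ℚ
... | c ∷ _ = c

log1p : Series
log1p zero    = 0ℚ
log1p (suc j) = sgn j * recipSuc j

logOverT : Series
logOverT j = sgn j * recipSuc j

recipOnePlus : Series
recipOnePlus j = sgn j

-- t / ((1+t) log(1+t))
baseS : Series
baseS = recipOnePlus ⊛ invS logOverT

qpow : ℚ → ℕ → ℚ
qpow q zero    = 1ℚ
qpow q (suc e) = q * qpow q e

-- coefficient 1/(m! (m+1)^k) of x^m in Lif_k(x), for k ∈ ℤ
lifCoeff : ℤ → ℕ → ℚ
lifCoeff (+ k)      m = recipFact m * qpow (recipSuc m) k
lifCoeff -[1+ j ]   m = recipFact m * qpow (ℕ→ℚ (suc m)) (suc j)

-- Lif_k(-log(1+t)) = Σ_m lifCoeff k m (-log(1+t))^m ; only m ≤ n contribute to t^n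
negLog : Series
negLog j = - log1p j

lifS : ℤ → Series
lifS k n = Σ≤ n (λ m → lifCoeff k m * powS negLog m n)

falling : ℚ → ℕ → ℚ
falling x zero    = 1ℚ
falling x (suc n) = falling x n * (x - ℕ→ℚ n)

binomS : ℚ → Series
binomS x n = falling x n * recipFact n

-- Ã_n^{(r,k)}(x) = n! [t^n] (t/((1+t)log(1+t)))^r Lif_k(-log(1+t)) (1+t)^x
Atilde : ℕ → ℤ → ℕ → ℚ → ℚ
Atilde r k n x = ℕ→ℚ (n !) * (powS baseS r ⊛ lifS k ⊛ binomS x) n

module Submission where

-- Ã_n^{(r,k)}(x) = n! [tⁿ] F_{r,k,x}, where F_{r,k,x} = B^r · Lif_k(-log(1+t)) · (1+t)^x
-- and B = t/((1+t)log(1+t)).  The recurrence is the coefficientwise form of a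
-- differential equation for F.  Let θ = t·d/dt be the Euler operator, the
-- derivation with [tⁿ] θF = n·[tⁿ] F, and ℓ = log(1+t)/t.  Then
--   θ(1+t)^x = x·t·(1+t)^{x-1},   θB = B·B·(ℓ - 1)   (since B·(1+t)ℓ = 1),
--   θ Lif_k(-log(1+t)) = B·(Lif_{k-1} - Lif_k)(-log(1+t))
-- (from θ(-log(1+t)) = -log(1+t)·B and (m+1)/(m!(m+1)^k) = 1/(m!(m+1)^{k-1})),
-- so by the Leibniz rule
--   θF_{r,k,x} = x·t·F_{r,k,x-1} + r·(ℓ - 1)·F_{r+1,k,x} + F_{r+1,k-1,x} - F_{r+1,k,x}.
-- Taking the coefficient of tⁿ, with ℓ - 1 = Σ_a (-1)^{a+1} t^{a+1}/(a+2), and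
-- multiplying by (n-1)! gives the theorem (for every r, in fact).

open import Defs
open import Data.Nat as ℕ using (ℕ; zero; suc; _∸_; _≤_; _<_; _!; NonZero; z≤n; s≤s)
import Data.Nat.Properties as ℕP
open import Data.Nat.Combinatorics using (_C_; nCk≡n!/k![n-k]!; k![n∸k]!∣n!)
open import Data.Nat.DivMod using (m/n*n≡m)
open import Data.Nat.Coprimality using (1-coprimeTo)
import Data.Nat.Coprimality as Coprimality
open import Data.Integer as ℤ using (ℤ; -[1+_])
import Data.Integer.Properties as ℤP
open import Data.Rational using (ℚ; mkℚ; _/_; _+_; _*_; _-_; -_; 0ℚ; 1ℚ)
import Data.Rational.Properties as ℚP
open import Data.List using (_∷_; zipWith; foldr; map; applyUpTo; downFrom)
open import Data.Product using (_,_)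
open import Data.Maybe as Maybe using (Maybe)
open import Algebra.Bundles using (CommutativeRing)
open import Algebra.Structures using (IsCommutativeRing)
import Algebra.Solver.Ring
import Algebra.Solver.Ring.AlmostCommutativeRing as ACR
open import Relation.Binary.PropositionalEquality
open import Relation.Nullary.Decidable using (dec⇒maybe)
open import Tactic.RingSolver using (solve-∀)
open import Tactic.RingSolver.Core.AlmostCommutativeRing using (AlmostCommutativeRing; fromCommutativeRing)

module Rationals where

  open ≡-Reasoning

  ℚ-ring : AlmostCommutativeRing _ _
  ℚ-ring = fromCommutativeRing ℚP.+-*-commutativeRing (λ q → dec⇒maybe (0ℚ ℚP.≟ q))

  -- ℕ→ℚ m is already in normal form m/1; hence ℕ→ℚ is a semiring
  -- homomorphism, and 1/(j+1), 1/m! of Defs are inverses of j+1 and m!.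
  ℕ→ℚ-mkℚ : ∀ m → ℕ→ℚ m ≡ mkℚ (ℤ.+ m) 0 (Coprimality.sym (1-coprimeTo m))
  ℕ→ℚ-mkℚ m = ℚP.normalize-coprime _

  ℕ→ℚ-+ : ∀ m n → ℕ→ℚ (m ℕ.+ n) ≡ ℕ→ℚ m + ℕ→ℚ n
  ℕ→ℚ-+ m n rewrite ℕ→ℚ-mkℚ m | ℕ→ℚ-mkℚ n =
    cong (_/ 1) (sym (cong₂ ℤ._+_ (ℤP.*-identityʳ (ℤ.+ m)) (ℤP.*-identityʳ (ℤ.+ n))))

  ℕ→ℚ-* : ∀ m n → ℕ→ℚ (m ℕ.* n) ≡ ℕ→ℚ m * ℕ→ℚ n
  ℕ→ℚ-* m n rewrite ℕ→ℚ-mkℚ m | ℕ→ℚ-mkℚ n = cong (_/ 1) (ℤP.pos-* m n)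

  ℕ→ℚ-suc : ∀ n → ℕ→ℚ (suc n) ≡ 1ℚ + ℕ→ℚ n
  ℕ→ℚ-suc n = ℕ→ℚ-+ 1 n

  ℕ→ℚ-/ : ∀ d .{{_ : NonZero d}} → ℕ→ℚ d * (ℤ.+ 1 / d) ≡ 1ℚ
  ℕ→ℚ-/ (suc j) rewrite ℕ→ℚ-mkℚ (suc j) | ℚP.normalize-coprime (1-coprimeTo (suc j)) =
    ℚP.*-inverseʳ (mkℚ (ℤ.+ suc j) 0 (Coprimality.sym (1-coprimeTo (suc j))))

  recipSuc-inverse : ∀ j → ℕ→ℚ (suc j) * recipSuc j ≡ 1ℚ
  recipSuc-inverse j = ℕ→ℚ-/ (suc j)

  recipFact-inverse : ∀ m → ℕ→ℚ (m !) * recipFact m ≡ 1ℚ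
  recipFact-inverse m = ℕ→ℚ-/ (m !) {{ℕP._!≢0 m}}

  recipFact-suc : ∀ n → ℕ→ℚ (suc n) * recipFact (suc n) ≡ recipFact n
  recipFact-suc n = begin
    s * r'                  ≡⟨ sym (ℚP.*-identityʳ _) ⟩
    s * r' * 1ℚ             ≡⟨ cong (s * r' *_) (sym (recipFact-inverse n)) ⟩
    s * r' * (F * r)        ≡⟨ regroup s r' F r ⟩
    s * F * r' * r          ≡⟨ cong (λ z → z * r' * r) (sym (ℕ→ℚ-* (suc n) (n !))) ⟩
    ℕ→ℚ (suc n !) * r' * r  ≡⟨ cong (_* r) (recipFact-inverse (suc n)) ⟩
    1ℚ * r                  ≡⟨ ℚP.*-identityˡ r ⟩
    r                       ∎
    where
    s = ℕ→ℚ (suc n); r' = recipFact (suc n); F = ℕ→ℚ (n !); r = recipFact n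
    regroup : ∀ s r' F r → s * r' * (F * r) ≡ s * F * r' * r
    regroup = solve-∀ ℚ-ring

  factorial-binomial : ∀ {m a} → a ≤ m → a ! ℕ.* (m C a) ℕ.* (m ∸ a) ! ≡ m !
  factorial-binomial {m} {a} a≤m = begin
    a ! ℕ.* (m C a) ℕ.* (m ∸ a) !    ≡⟨ cong (ℕ._* (m ∸ a) !) (ℕP.*-comm (a !) (m C a)) ⟩
    (m C a) ℕ.* a ! ℕ.* (m ∸ a) !    ≡⟨ ℕP.*-assoc (m C a) (a !) ((m ∸ a) !) ⟩
    (m C a) ℕ.* d                    ≡⟨ cong (ℕ._* d) (nCk≡n!/k![n-k]! a≤m) ⟩
    (m ! ℕ./ d) ℕ.* d                ≡⟨ m/n*n≡m (k![n∸k]!∣n! a≤m) ⟩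
    m !                              ∎
    where
    d = a ! ℕ.* (m ∸ a) !
    instance _ = ℕP._!*_!≢0 a (m ∸ a)

  recipSuc-factorial : ∀ m → recipSuc m * ℕ→ℚ (suc m !) ≡ ℕ→ℚ (m !)
  recipSuc-factorial m = begin
    recipSuc m * ℕ→ℚ (suc m !)               ≡⟨ cong (recipSuc m *_) (ℕ→ℚ-* (suc m) (m !)) ⟩
    recipSuc m * (ℕ→ℚ (suc m) * ℕ→ℚ (m !))   ≡⟨ ℚP.*-assoc (recipSuc m) (ℕ→ℚ (suc m)) (ℕ→ℚ (m !)) ⟨
    recipSuc m * ℕ→ℚ (suc m) * ℕ→ℚ (m !)     ≡⟨ cong (_* ℕ→ℚ (m !)) (trans (ℚP.*-comm (recipSuc m) _) (recipSuc-inverse m)) ⟩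
    1ℚ * ℕ→ℚ (m !)                           ≡⟨ ℚP.*-identityˡ (ℕ→ℚ (m !)) ⟩
    ℕ→ℚ (m !)                                ∎

open Rationals

-- Coefficient identities of the series of Defs.  Each is the coefficientwise
-- form of a derivative formula (θ = t·d/dt) used in the differential equation.
module CoefficientIdentities where

  open ≡-Reasoning

  -- j · (-1)ʲ/(j+1) = (-1)ʲ - (-1)ʲ/(j+1); coefficientwise form of θℓ = 1/(1+t) - ℓ
  -- for ℓ = log(1+t)/t.
  logOverT-θ : ∀ j → ℕ→ℚ j * logOverT j ≡ recipOnePlus j + - logOverT j
  logOverT-θ j = begin
    a * (s * r)                         ≡⟨ regroup a r s ⟩
    s * ((1ℚ + a) * r) + - (s * r)      ≡⟨ cong (λ u → s * (u * r) + - (s * r)) (sym (ℕ→ℚ-suc j)) ⟩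
    s * (ℕ→ℚ (suc j) * r) + - (s * r)   ≡⟨ cong (λ u → s * u + - (s * r)) (recipSuc-inverse j) ⟩
    s * 1ℚ + - (s * r)                  ≡⟨ cong (_+ - (s * r)) (ℚP.*-identityʳ s) ⟩
    s + - (s * r)                       ∎
    where
    a = ℕ→ℚ j; s = sgn j; r = recipSuc j
    regroup : ∀ a r s → a * (s * r) ≡ s * ((1ℚ + a) * r) + - (s * r)
    regroup = solve-∀ ℚ-ring

  falling-suc : ∀ x n → falling x (suc n) ≡ x * falling (x - 1ℚ) n
  falling-suc x zero    = base x
    where
    base : ∀ x → 1ℚ * (x - 0ℚ) ≡ x * 1ℚ
    base = solve-∀ ℚ-ring
  falling-suc x (suc n) = begin
    falling x (suc n) * (x - ℕ→ℚ (suc n))         ≡⟨ cong₂ (λ u v → u * (x - v)) (falling-suc x n) (ℕ→ℚ-suc n) ⟩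
    x * falling (x - 1ℚ) n * (x - (1ℚ + ℕ→ℚ n))  ≡⟨ regroup x (falling (x - 1ℚ) n) (ℕ→ℚ n) ⟩
    x * (falling (x - 1ℚ) n * ((x - 1ℚ) - ℕ→ℚ n)) ∎
    where
    regroup : ∀ x f a → x * f * (x - (1ℚ + a)) ≡ x * (f * ((x - 1ℚ) - a))
    regroup = solve-∀ ℚ-ring

  -- (n+1) · [t^{n+1}] (1+t)^x = x · [tⁿ] (1+t)^{x-1}; coefficientwise form of
  -- θ(1+t)^x = x t (1+t)^{x-1}.
  binomS-θ : ∀ x n → ℕ→ℚ (suc n) * binomS x (suc n) ≡ x * binomS (x - 1ℚ) n
  binomS-θ x n = begin
    s * (falling x (suc n) * r')         ≡⟨ cong (λ u → s * (u * r')) (falling-suc x n) ⟩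
    s * (x * f * r')                     ≡⟨ regroup s x f r' ⟩
    x * (f * (s * r'))                   ≡⟨ cong (λ u → x * (f * u)) (recipFact-suc n) ⟩
    x * (f * recipFact n)                ∎
    where
    s = ℕ→ℚ (suc n); f = falling (x - 1ℚ) n; r' = recipFact (suc n)
    regroup : ∀ s x f r → s * (x * f * r) ≡ x * (f * (s * r))
    regroup = solve-∀ ℚ-ring

  lifCoeff-pred : ∀ k m → lifCoeff (k ℤ.- ℤ.+ 1) m ≡ lifCoeff k m + ℕ→ℚ m * lifCoeff k m
  lifCoeff-pred (ℤ.+ zero) m = trans (cong (λ u → recipFact m * (u * 1ℚ)) (ℕ→ℚ-suc m))
                                   (regroup (recipFact m) (ℕ→ℚ m))
    where
    regroup : ∀ f a → f * ((1ℚ + a) * 1ℚ) ≡ f * 1ℚ + a * (f * 1ℚ)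
    regroup = solve-∀ ℚ-ring
  lifCoeff-pred (ℤ.+ suc j) m = begin
    f * q                              ≡⟨ ℚP.*-identityˡ (f * q) ⟨
    1ℚ * (f * q)                       ≡⟨ cong (_* (f * q)) (sym (recipSuc-inverse m)) ⟩
    ℕ→ℚ (suc m) * r * (f * q)          ≡⟨ cong (λ u → u * r * (f * q)) (ℕ→ℚ-suc m) ⟩
    (1ℚ + a) * r * (f * q)             ≡⟨ regroup f r q a ⟩
    f * (r * q) + a * (f * (r * q))    ∎
    where
    f = recipFact m; r = recipSuc m; q = qpow r j; a = ℕ→ℚ m
    regroup : ∀ f r q a → (1ℚ + a) * r * (f * q) ≡ f * (r * q) + a * (f * (r * q))
    regroup = solve-∀ ℚ-ring
  -- here k - 1 computes to -[1+ suc (j + 0) ]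
  lifCoeff-pred -[1+ j ] m rewrite ℕP.+-identityʳ j = begin
    f * (s * (s * qpow s j))               ≡⟨ cong (λ u → f * (u * (u * qpow u j))) (ℕ→ℚ-suc m) ⟩
    f * ((1ℚ + a) * ((1ℚ + a) * qpow (1ℚ + a) j))
       ≡⟨ regroup f a (qpow (1ℚ + a) j) ⟩
    f * ((1ℚ + a) * qpow (1ℚ + a) j) + a * (f * ((1ℚ + a) * qpow (1ℚ + a) j))
       ≡⟨ cong (λ u → f * (u * qpow u j) + a * (f * (u * qpow u j))) (sym (ℕ→ℚ-suc m)) ⟩
    f * (s * qpow s j) + a * (f * (s * qpow s j)) ∎
    where
    f = recipFact m; s = ℕ→ℚ (suc m); a = ℕ→ℚ m
    regroup : ∀ f a q → f * ((1ℚ + a) * ((1ℚ + a) * q)) ≡ f * ((1ℚ + a) * q) + a * (f * ((1ℚ + a) * q))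
    regroup = solve-∀ ℚ-ring

open CoefficientIdentities

module FiniteSums where

  open ≡-Reasoning

  Σ-cong≤ : ∀ n {f g : ℕ → ℚ} → (∀ i → i ≤ n → f i ≡ g i) → Σ≤ n f ≡ Σ≤ n g
  Σ-cong≤ zero    f≡g = f≡g 0 z≤n
  Σ-cong≤ (suc n) f≡g =
    cong₂ _+_ (Σ-cong≤ n (λ i i≤n → f≡g i (ℕP.m≤n⇒m≤1+n i≤n))) (f≡g (suc n) ℕP.≤-refl)

  Σ-cong : ∀ n {f g : ℕ → ℚ} → (∀ i → f i ≡ g i) → Σ≤ n f ≡ Σ≤ n g
  Σ-cong n f≡g = Σ-cong≤ n (λ i _ → f≡g i)

  Σ-zero : ∀ n → Σ≤ n (λ _ → 0ℚ) ≡ 0ℚ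
  Σ-zero zero    = refl
  Σ-zero (suc n) = cong (_+ 0ℚ) (Σ-zero n)

  Σ-+ : ∀ n (f g : ℕ → ℚ) → Σ≤ n (λ i → f i + g i) ≡ Σ≤ n f + Σ≤ n g
  Σ-+ zero    f g = refl
  Σ-+ (suc n) f g = trans (cong (_+ (f (suc n) + g (suc n))) (Σ-+ n f g))
                          (interchange (Σ≤ n f) (Σ≤ n g) (f (suc n)) (g (suc n)))
    where
    interchange : ∀ a b c d → (a + b) + (c + d) ≡ (a + c) + (b + d)
    interchange = solve-∀ ℚ-ring

  Σ-neg : ∀ n (f : ℕ → ℚ) → - Σ≤ n f ≡ Σ≤ n (λ i → - f i)
  Σ-neg zero    f = refl
  Σ-neg (suc n) f = trans (ℚP.neg-distrib-+ (Σ≤ n f) (f (suc n))) (cong (_+ - f (suc n)) (Σ-neg n f))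

  Σ-*ˡ : ∀ n c (f : ℕ → ℚ) → c * Σ≤ n f ≡ Σ≤ n (λ i → c * f i)
  Σ-*ˡ zero    c f = refl
  Σ-*ˡ (suc n) c f = trans (ℚP.*-distribˡ-+ c (Σ≤ n f) (f (suc n))) (cong (_+ c * f (suc n)) (Σ-*ˡ n c f))

  Σ-*ʳ : ∀ n c (f : ℕ → ℚ) → Σ≤ n f * c ≡ Σ≤ n (λ i → f i * c)
  Σ-*ʳ n c f = trans (ℚP.*-comm (Σ≤ n f) c) (trans (Σ-*ˡ n c f) (Σ-cong n (λ i → ℚP.*-comm c (f i))))

  Σ-first : ∀ n (f : ℕ → ℚ) → Σ≤ (suc n) f ≡ f 0 + Σ≤ n (λ i → f (suc i))
  Σ-first zero    f = refl
  Σ-first (suc n) f = trans (cong (_+ f (suc (suc n))) (Σ-first n f)) (ℚP.+-assoc (f 0) _ _)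

  Σ-reverse : ∀ n (f : ℕ → ℚ) → Σ≤ n f ≡ Σ≤ n (λ i → f (n ∸ i))
  Σ-reverse zero    f = refl
  Σ-reverse (suc n) f = begin
    Σ≤ n f + f (suc n)                   ≡⟨ cong (_+ f (suc n)) (Σ-reverse n f) ⟩
    Σ≤ n (λ i → f (n ∸ i)) + f (suc n)   ≡⟨ ℚP.+-comm _ (f (suc n)) ⟩
    f (suc n) + Σ≤ n (λ i → f (n ∸ i))   ≡⟨ Σ-first n (λ i → f (suc n ∸ i)) ⟨
    Σ≤ (suc n) (λ i → f (suc n ∸ i))     ∎

  Σ-swap : ∀ n N (F : ℕ → ℕ → ℚ) →
           Σ≤ n (λ i → Σ≤ N (F i)) ≡ Σ≤ N (λ m → Σ≤ n (λ i → F i m))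
  Σ-swap zero    N F = refl
  Σ-swap (suc n) N F = trans (cong (_+ Σ≤ N (F (suc n))) (Σ-swap n N F))
                             (sym (Σ-+ N (λ m → Σ≤ n (λ i → F i m)) (F (suc n))))

  Σ-triangle : ∀ n (F : ℕ → ℕ → ℚ) →
    Σ≤ n (λ i → Σ≤ i (λ j → F j i)) ≡ Σ≤ n (λ j → Σ≤ (n ∸ j) (λ l → F j (j ℕ.+ l)))
  Σ-triangle zero    F = refl
  Σ-triangle (suc n) F = begin
    Σ≤ n (λ i → Σ≤ i (λ j → F j i)) + (Σ≤ n (λ j → F j (suc n)) + F (suc n) (suc n))
      ≡⟨ cong (_+ (Σ≤ n (λ j → F j (suc n)) + F (suc n) (suc n))) (Σ-triangle n F) ⟩
    R n + (Σ≤ n (λ j → F j (suc n)) + F (suc n) (suc n))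
      ≡⟨ ℚP.+-assoc (R n) _ _ ⟨
    (R n + Σ≤ n (λ j → F j (suc n))) + F (suc n) (suc n)
      ≡⟨ cong₂ _+_ (sym (Σ-+ n _ _)) (cong (F (suc n)) (sym (ℕP.+-identityʳ (suc n)))) ⟩
    Σ≤ n (λ j → Σ≤ (n ∸ j) (λ l → F j (j ℕ.+ l)) + F j (suc n)) + F (suc n) (suc n ℕ.+ 0)
      ≡⟨ cong₂ _+_ (Σ-cong≤ n extend) (cong (λ b → Σ≤ b (λ l → F (suc n) (suc n ℕ.+ l))) (sym (ℕP.n∸n≡0 n))) ⟩
    R (suc n) ∎
    where
    R : ℕ → ℚ
    R m = Σ≤ m (λ j → Σ≤ (m ∸ j) (λ l → F j (j ℕ.+ l)))
    -- the inner sum of row j gains its term at i = n+1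
    extend : ∀ j → j ≤ n →
      Σ≤ (n ∸ j) (λ l → F j (j ℕ.+ l)) + F j (suc n) ≡ Σ≤ (suc n ∸ j) (λ l → F j (j ℕ.+ l))
    extend j j≤n rewrite ℕP.+-∸-assoc 1 j≤n =
      cong (λ i → Σ≤ (n ∸ j) (λ l → F j (j ℕ.+ l)) + F j i)
           (trans (cong suc (sym (ℕP.m+[n∸m]≡n j≤n))) (sym (ℕP.+-suc j (n ∸ j))))

  Σ-truncate : ∀ i d (f : ℕ → ℚ) → (∀ m → i < m → f m ≡ 0ℚ) → Σ≤ (i ℕ.+ d) f ≡ Σ≤ i f
  Σ-truncate i zero    f tail = cong (λ b → Σ≤ b f) (ℕP.+-identityʳ i)
  Σ-truncate i (suc d) f tail rewrite ℕP.+-suc i d =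
    trans (cong₂ _+_ (Σ-truncate i d f tail) (tail (suc (i ℕ.+ d)) (s≤s (ℕP.m≤m+n i d))))
          (ℚP.+-identityʳ _)

open FiniteSums

module Convolution where

  open ≡-Reasoning

  ⊛-cong≤ : ∀ n {f f' g g' : Series} → (∀ i → i ≤ n → f i ≡ f' i) → (∀ i → i ≤ n → g i ≡ g' i) →
            (f ⊛ g) n ≡ (f' ⊛ g') n
  ⊛-cong≤ n f≡f' g≡g' = Σ-cong≤ n (λ i i≤n → cong₂ _*_ (f≡f' i i≤n) (g≡g' (n ∸ i) (ℕP.m∸n≤m n i)))

  ⊛-cong : ∀ {f f' g g' : Series} → (∀ i → f i ≡ f' i) → (∀ i → g i ≡ g' i) → ∀ n → (f ⊛ g) n ≡ (f' ⊛ g') n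
  ⊛-cong f≡f' g≡g' n = ⊛-cong≤ n (λ i _ → f≡f' i) (λ i _ → g≡g' i)

  ⊛-comm : ∀ (f g : Series) n → (f ⊛ g) n ≡ (g ⊛ f) n
  ⊛-comm f g n = trans (Σ-reverse n _) (Σ-cong≤ n (λ i i≤n →
    trans (cong (λ j → f (n ∸ i) * g j) (ℕP.m∸[m∸n]≡n i≤n)) (ℚP.*-comm (f (n ∸ i)) (g i))))

  ⊛-assoc : ∀ (f g h : Series) n → ((f ⊛ g) ⊛ h) n ≡ (f ⊛ (g ⊛ h)) n
  ⊛-assoc f g h n = begin
    Σ≤ n (λ i → Σ≤ i (λ j → f j * g (i ∸ j)) * h (n ∸ i))
      ≡⟨ Σ-cong n (λ i → Σ-*ʳ i (h (n ∸ i)) _) ⟩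
    Σ≤ n (λ i → Σ≤ i (λ j → f j * g (i ∸ j) * h (n ∸ i)))
      ≡⟨ Σ-triangle n (λ j i → f j * g (i ∸ j) * h (n ∸ i)) ⟩
    Σ≤ n (λ j → Σ≤ (n ∸ j) (λ l → f j * g (j ℕ.+ l ∸ j) * h (n ∸ (j ℕ.+ l))))
      ≡⟨ Σ-cong n (λ j → Σ-cong (n ∸ j) (λ l →
           trans (cong₂ (λ a b → f j * g a * h b) (ℕP.m+n∸m≡n j l) (sym (ℕP.∸-+-assoc n j l)))
                 (ℚP.*-assoc (f j) (g l) (h (n ∸ j ∸ l))))) ⟩
    Σ≤ n (λ j → Σ≤ (n ∸ j) (λ l → f j * (g l * h (n ∸ j ∸ l))))
      ≡⟨ Σ-cong n (λ j → sym (Σ-*ˡ (n ∸ j) (f j) _)) ⟩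
    Σ≤ n (λ j → f j * Σ≤ (n ∸ j) (λ l → g l * h (n ∸ j ∸ l)))
      ∎

  ⊛-distribˡ : ∀ (f g h : Series) n → (f ⊛ (λ i → g i + h i)) n ≡ (f ⊛ g) n + (f ⊛ h) n
  ⊛-distribˡ f g h n = trans (Σ-cong n (λ i → ℚP.*-distribˡ-+ (f i) (g (n ∸ i)) (h (n ∸ i)))) (Σ-+ n _ _)

  ⊛-identityˡ : ∀ (g : Series) n → (oneS ⊛ g) n ≡ g n
  ⊛-identityˡ g zero    = ℚP.*-identityˡ (g 0)
  ⊛-identityˡ g (suc n) = begin
    (oneS ⊛ g) (suc n)                              ≡⟨ Σ-first n _ ⟩
    1ℚ * g (suc n) + Σ≤ n (λ i → 0ℚ * g (n ∸ i))    ≡⟨ cong₂ _+_ (ℚP.*-identityˡ (g (suc n)))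
                                                        (trans (Σ-cong n (λ i → ℚP.*-zeroˡ (g (n ∸ i)))) (Σ-zero n)) ⟩
    g (suc n) + 0ℚ                                  ≡⟨ ℚP.+-identityʳ (g (suc n)) ⟩
    g (suc n)                                       ∎

  invList-coefficients : ∀ g n → invList g n ≡ map (invS g) (downFrom (suc n))
  invList-coefficients g zero    = refl
  invList-coefficients g (suc n) = cong (invS g (suc n) ∷_) (invList-coefficients g n)

  foldr-zipWith-Σ : ∀ (φ : ℕ → ℚ) (f : ℕ → ℕ) (h : ℕ → ℚ) n →
    foldr _+_ 0ℚ (zipWith _*_ (map φ (applyUpTo f (suc n))) (map h (downFrom (suc n))))
    ≡ Σ≤ n (λ i → φ (f i) * h (n ∸ i))
  foldr-zipWith-Σ φ f h zero    = ℚP.+-identityʳ _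
  foldr-zipWith-Σ φ f h (suc n) =
    trans (cong (φ (f 0) * h (suc n) +_) (foldr-zipWith-Σ φ (λ i → f (suc i)) h n))
          (sym (Σ-first n (λ i → φ (f i) * h (suc n ∸ i))))

  invS-suc : ∀ g n → invS g (suc n) ≡ - Σ≤ n (λ i → g (suc i) * invS g (n ∸ i))
  invS-suc g n = cong -_ (begin
    foldr _+_ 0ℚ (zipWith _*_ (map (λ i → g (suc i)) (applyUpTo (λ i → i) (suc n))) (invList g n))
      ≡⟨ cong (λ l → foldr _+_ 0ℚ (zipWith _*_ (map (λ i → g (suc i)) (applyUpTo (λ i → i) (suc n))) l))
              (invList-coefficients g n) ⟩
    foldr _+_ 0ℚ (zipWith _*_ (map (λ i → g (suc i)) (applyUpTo (λ i → i) (suc n))) (map (invS g) (downFrom (suc n))))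
      ≡⟨ foldr-zipWith-Σ (λ i → g (suc i)) (λ i → i) (invS g) n ⟩
    Σ≤ n (λ i → g (suc i) * invS g (n ∸ i)) ∎)

  invS-inverse : ∀ g → g 0 ≡ 1ℚ → ∀ n → (g ⊛ invS g) n ≡ oneS n
  invS-inverse g g0≡1 zero    = cong (_* 1ℚ) g0≡1
  invS-inverse g g0≡1 (suc n) = begin
    (g ⊛ invS g) (suc n)                   ≡⟨ Σ-first n _ ⟩
    g 0 * invS g (suc n) + S               ≡⟨ cong₂ (λ u v → u * v + S) g0≡1 (invS-suc g n) ⟩
    1ℚ * - S + S                           ≡⟨ cancel S ⟩
    0ℚ                                     ∎
    where
    S = Σ≤ n (λ i → g (suc i) * invS g (n ∸ i))
    cancel : ∀ S → 1ℚ * - S + S ≡ 0ℚ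
    cancel = solve-∀ ℚ-ring

  -- Multiplication by t shifts coefficients up by one degree.
  shift : Series → Series
  shift f zero    = 0ℚ
  shift f (suc n) = f n

  shift-⊛ : ∀ (f g : Series) n → (shift f ⊛ g) n ≡ shift (f ⊛ g) n
  shift-⊛ f g zero    = ℚP.*-zeroˡ (g 0)
  shift-⊛ f g (suc n) = trans (Σ-first n _)
    (trans (cong (_+ (f ⊛ g) n) (ℚP.*-zeroˡ (g (suc n)))) (ℚP.+-identityˡ _))

  powS-vanish : ∀ (f : Series) → f 0 ≡ 0ℚ → ∀ m i → i < m → powS f m i ≡ 0ℚ
  powS-vanish f f0≡0 (suc m) zero    i<m = trans (cong (_* powS f m 0) f0≡0) (ℚP.*-zeroˡ (powS f m 0))
  powS-vanish f f0≡0 (suc m) (suc i) (s≤s i<m) = begin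
    (f ⊛ powS f m) (suc i)                                             ≡⟨ Σ-first i _ ⟩
    f 0 * powS f m (suc i) + Σ≤ i (λ j → f (suc j) * powS f m (i ∸ j)) ≡⟨ cong₂ _+_ first rest ⟩
    0ℚ + 0ℚ                                                            ≡⟨⟩
    0ℚ                                                                 ∎
    where
    first : f 0 * powS f m (suc i) ≡ 0ℚ
    first = trans (cong (_* powS f m (suc i)) f0≡0) (ℚP.*-zeroˡ (powS f m (suc i)))
    rest : Σ≤ i (λ j → f (suc j) * powS f m (i ∸ j)) ≡ 0ℚ
    rest = trans (Σ-cong≤ i (λ j j≤i →
             trans (cong (f (suc j) *_) (powS-vanish f f0≡0 m (i ∸ j) (ℕP.≤-<-trans (ℕP.m∸n≤m i j) i<m)))
                   (ℚP.*-zeroʳ (f (suc j)))))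
           (Σ-zero i)

open Convolution

-- Formal power series as a commutative ring with coefficientwise equality.
-- With ℚ embedded as constant series, identities between series are
-- normalised by the ring solver SeriesSolver.
module SeriesRing where

  open ≡-Reasoning

  -- A power series; without η, the operations below stay neutral terms, which
  -- lets Agda infer the series in implicit arguments.
  record Ser : Set where
    no-eta-equality
    constructor ser
    field coef : Series
  open Ser public

  infix 4 _≈_
  record _≈_ (a b : Ser) : Set where
    constructor ≈ᶜ
    field at : ∀ n → coef a n ≡ coef b n
  open _≈_ public

  infixl 6 _+ₛ_
  infixl 7 _*ₛ_
  infix 8 -ₛ_

  _+ₛ_ : Ser → Ser → Ser
  coef (a +ₛ b) n = coef a n + coef b n

  -ₛ_ : Ser → Ser
  coef (-ₛ a) n = - coef a n

  _*ₛ_ : Ser → Ser → Ser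
  coef (a *ₛ b) = coef a ⊛ coef b

  const : ℚ → Ser
  coef (const c) zero    = c
  coef (const c) (suc n) = 0ℚ

  const-*ₛ : ∀ c a n → coef (const c *ₛ a) n ≡ c * coef a n
  const-*ₛ c a zero    = refl
  const-*ₛ c a (suc n) = begin
    coef (const c *ₛ a) (suc n)                            ≡⟨ Σ-first n _ ⟩
    c * coef a (suc n) + Σ≤ n (λ i → 0ℚ * coef a (n ∸ i))  ≡⟨ cong (c * coef a (suc n) +_)
                                                              (trans (Σ-cong n (λ i → ℚP.*-zeroˡ (coef a (n ∸ i)))) (Σ-zero n)) ⟩
    c * coef a (suc n) + 0ℚ                                ≡⟨ ℚP.+-identityʳ _ ⟩
    c * coef a (suc n)                                     ∎

  0ₛ 1ₛ : Ser
  coef 0ₛ n = 0ℚ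
  1ₛ = const 1ℚ

  1ₛ-coef : ∀ n → coef 1ₛ n ≡ oneS n
  1ₛ-coef zero    = refl
  1ₛ-coef (suc n) = refl

  series-isCommutativeRing : IsCommutativeRing _≈_ _+ₛ_ _*ₛ_ -ₛ_ 0ₛ 1ₛ
  series-isCommutativeRing = record
    { isRing = record
      { +-isAbelianGroup = record
        { isGroup = record
          { isMonoid = record
            { isSemigroup = record
              { isMagma = record
                { isEquivalence = record
                  { refl  = ≈ᶜ (λ n → refl)
                  ; sym   = λ a≈b → ≈ᶜ (λ n → sym (at a≈b n))
                  ; trans = λ a≈b b≈c → ≈ᶜ (λ n → trans (at a≈b n) (at b≈c n)) }
                ; ∙-cong = λ a≈a' b≈b' → ≈ᶜ (λ n → cong₂ _+_ (at a≈a' n) (at b≈b' n)) }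
              ; assoc = λ a b c → ≈ᶜ (λ n → ℚP.+-assoc (coef a n) (coef b n) (coef c n)) }
            ; identity = (λ a → ≈ᶜ (λ n → ℚP.+-identityˡ (coef a n)))
                       , (λ a → ≈ᶜ (λ n → ℚP.+-identityʳ (coef a n))) }
          ; inverse = (λ a → ≈ᶜ (λ n → ℚP.+-inverseˡ (coef a n)))
                    , (λ a → ≈ᶜ (λ n → ℚP.+-inverseʳ (coef a n)))
          ; ⁻¹-cong = λ a≈b → ≈ᶜ (λ n → cong -_ (at a≈b n)) }
        ; comm = λ a b → ≈ᶜ (λ n → ℚP.+-comm (coef a n) (coef b n)) }
      ; *-cong = λ a≈a' b≈b' → ≈ᶜ (⊛-cong (at a≈a') (at b≈b'))
      ; *-assoc = λ a b c → ≈ᶜ (⊛-assoc (coef a) (coef b) (coef c))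
      ; *-identity = (λ a → ≈ᶜ (λ n → trans (⊛-cong {g = coef a} 1ₛ-coef (λ _ → refl) n) (⊛-identityˡ (coef a) n)))
                   , (λ a → ≈ᶜ (λ n → trans (⊛-cong {f = coef a} (λ _ → refl) 1ₛ-coef n)
                                     (trans (⊛-comm (coef a) oneS n) (⊛-identityˡ (coef a) n))))
      ; distrib = (λ a b c → ≈ᶜ (⊛-distribˡ (coef a) (coef b) (coef c)))
                , (λ a b c → ≈ᶜ (λ n → trans (⊛-comm (coef (b +ₛ c)) (coef a) n)
                     (trans (⊛-distribˡ (coef a) (coef b) (coef c) n)
                            (cong₂ _+_ (⊛-comm (coef a) (coef b) n) (⊛-comm (coef a) (coef c) n))))) }
    ; *-comm = λ a b → ≈ᶜ (⊛-comm (coef a) (coef b)) }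

  series-ring : CommutativeRing _ _
  series-ring = record { isCommutativeRing = series-isCommutativeRing }

  open CommutativeRing series-ring public
    using (+-cong; *-cong; -‿cong; *-assoc; zeroˡ; zeroʳ; +-identityˡ; *-identityʳ)
    renaming (setoid to series-setoid; refl to ≈-refl; sym to ≈-sym; trans to ≈-trans; reflexive to ≈-reflexive)


  -- ℚ ↦ const is a ring homomorphism, which lets the ring solver work over
  -- series with rational constants.
  const-+ : ∀ a b → const (a + b) ≈ const a +ₛ const b
  const-+ a b = ≈ᶜ λ { zero → refl ; (suc n) → refl }

  const-* : ∀ a b → const (a * b) ≈ const a *ₛ const b
  const-* a b = ≈ᶜ λ { zero → refl ; (suc n) → sym (trans (const-*ₛ a (const b) (suc n)) (ℚP.*-zeroʳ a)) }

  const-neg : ∀ a → const (- a) ≈ -ₛ const a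
  const-neg a = ≈ᶜ λ { zero → refl ; (suc n) → refl }

  const-0 : const 0ℚ ≈ 0ₛ
  const-0 = ≈ᶜ λ { zero → refl ; (suc n) → refl }

  const-homomorphism : ACR._-Raw-AlmostCommutative⟶_
                         (CommutativeRing.rawRing ℚP.+-*-commutativeRing) (ACR.fromCommutativeRing series-ring)
  const-homomorphism = record
    { ⟦_⟧ = const ; +-homo = const-+ ; *-homo = const-* ; -‿homo = const-neg ; 0-homo = const-0 ; 1-homo = ≈-refl }

  const-≟ : ∀ a b → Maybe (const a ≈ const b)
  const-≟ a b = Maybe.map (λ a≡b → ≈-reflexive (cong const a≡b)) (dec⇒maybe (a ℚP.≟ b))

  module SeriesSolver = Algebra.Solver.Ring (CommutativeRing.rawRing ℚP.+-*-commutativeRing)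
                          (ACR.fromCommutativeRing series-ring) const-homomorphism const-≟

open SeriesRing

module EulerOperator where

  open import Relation.Binary.Reasoning.Setoid series-setoid
  open SeriesSolver using (solve; _:=_; _:+_; _:*_; :-_; con)

  tₛ : Ser
  coef tₛ = shift oneS

  tₛ-*ₛ : ∀ f → tₛ *ₛ ser f ≈ ser (shift f)
  tₛ-*ₛ f = ≈ᶜ λ n → trans (shift-⊛ oneS f n) (shift-identity n)
    where
    shift-identity : ∀ n → shift (oneS ⊛ f) n ≡ shift f n
    shift-identity zero    = refl
    shift-identity (suc n) = ⊛-identityˡ f n

  -- The Euler operator θ = t·d/dt acts on the coefficient of tⁿ as
  -- multiplication by n; it is a derivation (Leibniz rule θ-*).
  θ : Ser → Ser
  coef (θ a) n = ℕ→ℚ n * coef a n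

  θ-cong : ∀ {a b} → a ≈ b → θ a ≈ θ b
  θ-cong a≈b = ≈ᶜ λ n → cong (ℕ→ℚ n *_) (at a≈b n)

  θ-+ : ∀ a b → θ (a +ₛ b) ≈ θ a +ₛ θ b
  θ-+ a b = ≈ᶜ λ n → ℚP.*-distribˡ-+ (ℕ→ℚ n) (coef a n) (coef b n)

  θ-neg : ∀ a → θ (-ₛ a) ≈ -ₛ θ a
  θ-neg a = ≈ᶜ λ n → sym (ℚP.neg-distribʳ-* (ℕ→ℚ n) (coef a n))

  θ-* : ∀ a b → θ (a *ₛ b) ≈ θ a *ₛ b +ₛ a *ₛ θ b
  θ-* a b = ≈ᶜ λ n → trans (Σ-*ˡ n (ℕ→ℚ n) _) (trans (Σ-cong≤ n (split n)) (Σ-+ n _ _))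
    where
    distribute : ∀ u v x y → (u + v) * (x * y) ≡ u * x * y + x * (v * y)
    distribute = solve-∀ ℚ-ring
    -- n = i + (n - i) splits the factor n between the two coefficients
    split : ∀ n i → i ≤ n → ℕ→ℚ n * (coef a i * coef b (n ∸ i)) ≡
            ℕ→ℚ i * coef a i * coef b (n ∸ i) + coef a i * (ℕ→ℚ (n ∸ i) * coef b (n ∸ i))
    split n i i≤n = trans (cong (λ m → ℕ→ℚ m * (coef a i * coef b (n ∸ i))) (sym (ℕP.m+[n∸m]≡n i≤n)))
      (trans (cong (_* (coef a i * coef b (n ∸ i))) (ℕ→ℚ-+ i (n ∸ i)))
               (distribute (ℕ→ℚ i) (ℕ→ℚ (n ∸ i)) (coef a i) (coef b (n ∸ i))))

  θ-const : ∀ c → θ (const c) ≈ 0ₛ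
  θ-const c = ≈ᶜ λ { zero → ℚP.*-zeroˡ c ; (suc n) → ℚP.*-zeroʳ (ℕ→ℚ (suc n)) }

  θ-1 : θ 1ₛ ≈ 0ₛ
  θ-1 = θ-const 1ℚ

  θ-const-* : ∀ c a → θ (const c *ₛ a) ≈ const c *ₛ θ a
  θ-const-* c a = begin
    θ (const c *ₛ a)                        ≈⟨ θ-* (const c) a ⟩
    θ (const c) *ₛ a +ₛ const c *ₛ θ a      ≈⟨ +-cong (≈-trans (*-cong (θ-const c) (≈-refl {a})) (zeroˡ a)) ≈-refl ⟩
    0ₛ +ₛ const c *ₛ θ a                    ≈⟨ +-identityˡ (const c *ₛ θ a) ⟩
    const c *ₛ θ a                          ∎

  θ-t : θ tₛ ≈ tₛ
  θ-t = ≈ᶜ λ { zero → refl ; (suc zero) → refl ; (suc (suc n)) → ℚP.*-zeroʳ (ℕ→ℚ (suc (suc n))) }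

  infixr 8 _^ₛ_
  _^ₛ_ : Ser → ℕ → Ser
  a ^ₛ zero  = 1ₛ
  a ^ₛ suc m = a *ₛ a ^ₛ m

  powS-^ₛ : ∀ f m → ser (powS f m) ≈ ser f ^ₛ m
  powS-^ₛ f zero    = ≈ᶜ (λ n → sym (1ₛ-coef n))
  powS-^ₛ f (suc m) = ≈ᶜ (⊛-cong {f} (λ i → refl) (at (powS-^ₛ f m)))

  θ-^ₛ : ∀ {a b} → θ a ≈ a *ₛ b → ∀ m → θ (a ^ₛ m) ≈ const (ℕ→ℚ m) *ₛ a ^ₛ m *ₛ b
  θ-^ₛ {b = b} _ zero = begin
    θ 1ₛ                     ≈⟨ θ-1 ⟩
    0ₛ                       ≈⟨ const-0 ⟨
    const 0ℚ                 ≈⟨ solve 1 (λ b → con 0ℚ := con 0ℚ :* con 1ℚ :* b) ≈-refl b ⟩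
    const 0ℚ *ₛ 1ₛ *ₛ b      ∎
  θ-^ₛ {a} {b} θa (suc m) = begin
    θ (a *ₛ a ^ₛ m)                                   ≈⟨ θ-* a (a ^ₛ m) ⟩
    θ a *ₛ a ^ₛ m +ₛ a *ₛ θ (a ^ₛ m)                  ≈⟨ +-cong (*-cong θa ≈-refl) (*-cong ≈-refl (θ-^ₛ θa m)) ⟩
    a *ₛ b *ₛ a ^ₛ m +ₛ a *ₛ (const c *ₛ a ^ₛ m *ₛ b) ≈⟨ collect a b (a ^ₛ m) (const c) ⟩
    (const 1ℚ +ₛ const c) *ₛ (a *ₛ a ^ₛ m) *ₛ b      ≈⟨ *-cong (*-cong (≈-sym (const-+ 1ℚ c)) ≈-refl) ≈-refl ⟩
    const (1ℚ + c) *ₛ (a *ₛ a ^ₛ m) *ₛ b              ≈⟨ *-cong (*-cong (≈-reflexive (cong const (sym (ℕ→ℚ-suc m)))) ≈-refl) ≈-refl ⟩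
    const (ℕ→ℚ (suc m)) *ₛ (a *ₛ a ^ₛ m) *ₛ b         ∎
    where
    c = ℕ→ℚ m
    collect : ∀ a b p c → a *ₛ b *ₛ p +ₛ a *ₛ (c *ₛ p *ₛ b) ≈ (const 1ℚ +ₛ c) *ₛ (a *ₛ p) *ₛ b
    collect = solve 4 (λ a b p c → a :* b :* p :+ a :* (c :* p :* b) := (con 1ℚ :+ c) :* (a :* p) :* b) ≈-refl


  Σₛ : ℕ → (ℕ → Ser) → Ser
  coef (Σₛ N F) n = Σ≤ N (λ m → coef (F m) n)

  Σₛ-cong : ∀ N {F G} → (∀ m → F m ≈ G m) → Σₛ N F ≈ Σₛ N G
  Σₛ-cong N F≈G = ≈ᶜ λ n → Σ-cong N (λ m → at (F≈G m) n)

  Σₛ-- : ∀ N F G → Σₛ N F +ₛ -ₛ Σₛ N G ≈ Σₛ N (λ m → F m +ₛ -ₛ G m)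
  Σₛ-- N F G = ≈ᶜ λ n → trans (cong (Σ≤ N (λ m → coef (F m) n) +_) (Σ-neg N (λ m → coef (G m) n)))
                                (sym (Σ-+ N (λ m → coef (F m) n) (λ m → - coef (G m) n)))

  *ₛ-Σₛ : ∀ a N F → a *ₛ Σₛ N F ≈ Σₛ N (λ m → a *ₛ F m)
  *ₛ-Σₛ a N F = ≈ᶜ λ n → trans (Σ-cong n (λ i → Σ-*ˡ N (coef a i) (λ m → coef (F m) (n ∸ i))))
                                 (Σ-swap n N (λ i m → coef a i * coef (F m) (n ∸ i)))

  θ-Σₛ : ∀ N F → θ (Σₛ N F) ≈ Σₛ N (λ m → θ (F m))
  θ-Σₛ N F = ≈ᶜ λ n → Σ-*ˡ N (ℕ→ℚ n) (λ m → coef (F m) n)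

  θ-inverse : ∀ {a w} → a *ₛ w ≈ 1ₛ → θ a ≈ -ₛ (a *ₛ (a *ₛ θ w))
  θ-inverse {a} {w} aw≈1 = begin
    θ a                                              ≈⟨ *-identityʳ (θ a) ⟨
    θ a *ₛ 1ₛ                                         ≈⟨ *-cong ≈-refl aw≈1 ⟨
    θ a *ₛ (a *ₛ w)                                   ≈⟨ regroup (θ a) a w (θ w) ⟩
    a *ₛ (θ a *ₛ w +ₛ a *ₛ θ w) +ₛ -ₛ (a *ₛ (a *ₛ θ w)) ≈⟨ +-cong (*-cong ≈-refl (≈-sym (θ-* a w))) ≈-refl ⟩
    a *ₛ θ (a *ₛ w) +ₛ -ₛ (a *ₛ (a *ₛ θ w))            ≈⟨ +-cong (*-cong ≈-refl (≈-trans (θ-cong aw≈1) θ-1)) ≈-refl ⟩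
    a *ₛ 0ₛ +ₛ -ₛ (a *ₛ (a *ₛ θ w))                    ≈⟨ +-cong (zeroʳ a) ≈-refl ⟩
    0ₛ +ₛ -ₛ (a *ₛ (a *ₛ θ w))                         ≈⟨ +-identityˡ _ ⟩
    -ₛ (a *ₛ (a *ₛ θ w))                              ∎
    where
    regroup : ∀ e a w d → e *ₛ (a *ₛ w) ≈ a *ₛ (e *ₛ w +ₛ a *ₛ d) +ₛ -ₛ (a *ₛ (a *ₛ d))
    regroup = solve 4 (λ e a w d → e :* (a :* w) := a :* (e :* w :+ a :* d) :+ :- (a :* (a :* d))) ≈-refl

open EulerOperator

module DifferentialEquation where

  open import Relation.Binary.Reasoning.Setoid series-setoid
  open SeriesSolver using (solve; _:=_; _:+_; _:*_; :-_; con)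

  -- The series entering the generating function:
  -- 1/(1+t), ℓ = log(1+t)/t and its inverse, B = t/((1+t)log(1+t)),
  -- -log(1+t), and (1+t)^x.
  inv1+t ℓ ℓ⁻¹ B ν : Ser
  inv1+t = ser recipOnePlus
  ℓ      = ser logOverT
  ℓ⁻¹    = ser (invS logOverT)
  B      = ser baseS
  ν      = ser negLog

  binom : ℚ → Ser
  binom x = ser (binomS x)

  B≈ : B ≈ inv1+t *ₛ ℓ⁻¹
  B≈ = ≈ᶜ λ n → refl

  inv1+t-inverse : inv1+t +ₛ tₛ *ₛ inv1+t ≈ 1ₛ
  inv1+t-inverse = ≈-trans (+-cong ≈-refl (tₛ-*ₛ recipOnePlus)) (≈ᶜ telescope)
    where
    telescope : ∀ n → recipOnePlus n + shift recipOnePlus n ≡ coef 1ₛ n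
    telescope zero    = refl
    telescope (suc n) = ℚP.+-inverseˡ (sgn n)

  -- ℓ has constant term 1, so invS gives its inverse
  ℓ-inverse : ℓ *ₛ ℓ⁻¹ ≈ 1ₛ
  ℓ-inverse = ≈ᶜ λ n → trans (invS-inverse logOverT refl n) (sym (1ₛ-coef n))

  -- θℓ = 1/(1+t) - ℓ, since θ(tℓ) = θ log(1+t) = t/(1+t)
  θ-ℓ : θ ℓ ≈ inv1+t +ₛ -ₛ ℓ
  θ-ℓ = ≈ᶜ logOverT-θ

  ν≈ : ν ≈ -ₛ (tₛ *ₛ ℓ)
  ν≈ = ≈ᶜ λ n → trans (shifted n) (cong -_ (sym (at (tₛ-*ₛ logOverT) n)))
    where
    shifted : ∀ n → negLog n ≡ - shift logOverT n
    shifted zero    = refl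
    shifted (suc n) = refl

  -- (ℓ - 1)/t = Σ_a (-1)^{a+1} tᵃ/(a+2)
  ℓ-tail : Ser
  ℓ-tail = ser (λ a → logOverT (suc a))

  ℓ-1≈ : ℓ +ₛ -ₛ 1ₛ ≈ tₛ *ₛ ℓ-tail
  ℓ-1≈ = ≈-trans (≈ᶜ λ { zero → refl ; (suc a) → ℚP.+-identityʳ (logOverT (suc a)) })
                 (≈-sym (tₛ-*ₛ (λ a → logOverT (suc a))))

  θ-binom : ∀ x → θ (binom x) ≈ const x *ₛ (tₛ *ₛ binom (x - 1ℚ))
  θ-binom x = ≈ᶜ λ n → trans (coefficient n)
    (sym (trans (const-*ₛ x (tₛ *ₛ binom (x - 1ℚ)) n) (cong (x *_) (at (tₛ-*ₛ (binomS (x - 1ℚ))) n))))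
    where
    coefficient : ∀ n → ℕ→ℚ n * binomS x n ≡ x * shift (binomS (x - 1ℚ)) n
    coefficient zero    = trans (ℚP.*-zeroˡ (binomS x 0)) (sym (ℚP.*-zeroʳ x))
    coefficient (suc n) = binomS-θ x n

  -- B·(1+t)ℓ = 1, and θ((1+t)ℓ) = 1 - ℓ; hence θB = B·B(ℓ - 1).
  B-inverse : B *ₛ ((1ₛ +ₛ tₛ) *ₛ ℓ) ≈ 1ₛ
  B-inverse = begin
    B *ₛ ((1ₛ +ₛ tₛ) *ₛ ℓ)                     ≈⟨ *-cong B≈ ≈-refl ⟩
    inv1+t *ₛ ℓ⁻¹ *ₛ ((1ₛ +ₛ tₛ) *ₛ ℓ)          ≈⟨ regroup inv1+t ℓ⁻¹ tₛ ℓ ⟩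
    (inv1+t +ₛ tₛ *ₛ inv1+t) *ₛ (ℓ *ₛ ℓ⁻¹)     ≈⟨ *-cong inv1+t-inverse ℓ-inverse ⟩
    1ₛ *ₛ 1ₛ                                   ≈⟨ *-identityʳ 1ₛ ⟩
    1ₛ                                         ∎
    where
    regroup : ∀ r i t l → r *ₛ i *ₛ ((1ₛ +ₛ t) *ₛ l) ≈ (r +ₛ t *ₛ r) *ₛ (l *ₛ i)
    regroup = solve 4 (λ r i t l → r :* i :* ((con 1ℚ :+ t) :* l) := (r :+ t :* r) :* (l :* i)) ≈-refl

  θ-1+t·ℓ : θ ((1ₛ +ₛ tₛ) *ₛ ℓ) ≈ 1ₛ +ₛ -ₛ ℓ
  θ-1+t·ℓ = begin
    θ ((1ₛ +ₛ tₛ) *ₛ ℓ)                            ≈⟨ θ-* (1ₛ +ₛ tₛ) ℓ ⟩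
    θ (1ₛ +ₛ tₛ) *ₛ ℓ +ₛ (1ₛ +ₛ tₛ) *ₛ θ ℓ         ≈⟨ +-cong (*-cong θ-1+t ≈-refl) (*-cong ≈-refl θ-ℓ) ⟩
    tₛ *ₛ ℓ +ₛ (1ₛ +ₛ tₛ) *ₛ (inv1+t +ₛ -ₛ ℓ)      ≈⟨ regroup tₛ ℓ inv1+t ⟩
    (inv1+t +ₛ tₛ *ₛ inv1+t) +ₛ -ₛ ℓ               ≈⟨ +-cong inv1+t-inverse ≈-refl ⟩
    1ₛ +ₛ -ₛ ℓ                                     ∎
    where
    θ-1+t : θ (1ₛ +ₛ tₛ) ≈ tₛ
    θ-1+t = ≈-trans (θ-+ 1ₛ tₛ) (≈-trans (+-cong θ-1 θ-t) (+-identityˡ tₛ))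
    regroup : ∀ t l r → t *ₛ l +ₛ (1ₛ +ₛ t) *ₛ (r +ₛ -ₛ l) ≈ (r +ₛ t *ₛ r) +ₛ -ₛ l
    regroup = solve 3 (λ t l r → t :* l :+ (con 1ℚ :+ t) :* (r :+ :- l) := (r :+ t :* r) :+ :- l) ≈-refl

  θ-B : θ B ≈ B *ₛ (B *ₛ (ℓ +ₛ -ₛ 1ₛ))
  θ-B = begin
    θ B                                  ≈⟨ θ-inverse B-inverse ⟩
    -ₛ (B *ₛ (B *ₛ θ ((1ₛ +ₛ tₛ) *ₛ ℓ)))  ≈⟨ -‿cong (*-cong ≈-refl (*-cong ≈-refl θ-1+t·ℓ)) ⟩
    -ₛ (B *ₛ (B *ₛ (1ₛ +ₛ -ₛ ℓ)))        ≈⟨ solve 2 (λ b l → :- (b :* (b :* (con 1ℚ :+ :- l))) := b :* (b :* (l :+ :- con 1ℚ))) ≈-refl B ℓ ⟩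
    B *ₛ (B *ₛ (ℓ +ₛ -ₛ 1ₛ))             ∎

  θ-ν : θ ν ≈ ν *ₛ B
  θ-ν = begin
    θ ν                                      ≈⟨ θ-cong ν≈ ⟩
    θ (-ₛ (tₛ *ₛ ℓ))                          ≈⟨ θ-neg (tₛ *ₛ ℓ) ⟩
    -ₛ θ (tₛ *ₛ ℓ)                            ≈⟨ -‿cong (θ-* tₛ ℓ) ⟩
    -ₛ (θ tₛ *ₛ ℓ +ₛ tₛ *ₛ θ ℓ)                ≈⟨ -‿cong (+-cong (*-cong θ-t ≈-refl) (*-cong ≈-refl θ-ℓ)) ⟩
    -ₛ (tₛ *ₛ ℓ +ₛ tₛ *ₛ (inv1+t +ₛ -ₛ ℓ))     ≈⟨ regroup tₛ ℓ inv1+t ⟩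
    -ₛ (tₛ *ₛ inv1+t) *ₛ 1ₛ                   ≈⟨ *-cong ≈-refl ℓ-inverse ⟨
    -ₛ (tₛ *ₛ inv1+t) *ₛ (ℓ *ₛ ℓ⁻¹)            ≈⟨ solve 4 (λ t r l i → :- (t :* r) :* (l :* i) := :- (t :* l) :* (r :* i)) ≈-refl tₛ inv1+t ℓ ℓ⁻¹ ⟩
    -ₛ (tₛ *ₛ ℓ) *ₛ (inv1+t *ₛ ℓ⁻¹)            ≈⟨ *-cong (≈-sym ν≈) (≈-sym B≈) ⟩
    ν *ₛ B                                   ∎
    where
    regroup : ∀ t l r → -ₛ (t *ₛ l +ₛ t *ₛ (r +ₛ -ₛ l)) ≈ -ₛ (t *ₛ r) *ₛ 1ₛ
    regroup = solve 3 (λ t l r → :- (t :* l :+ t :* (r :+ :- l)) := :- (t :* r) :* con 1ℚ) ≈-refl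

  -- Lif_k(-log(1+t)) truncated after its term of index M.
  Lif : ℤ → ℕ → Ser
  Lif k M = Σₛ M (λ m → const (lifCoeff k m) *ₛ ν ^ₛ m)

  -- θ Lif_k(-log(1+t)) = B·(Lif_{k-1}(-log(1+t)) - Lif_k(-log(1+t))), termwise
  -- from θνᵐ = m·νᵐ·B and lifCoeff (k-1) m = (m+1)·lifCoeff k m.
  θ-Lif : ∀ k M → θ (Lif k M) ≈ B *ₛ (Lif (k ℤ.- ℤ.+ 1) M +ₛ -ₛ Lif k M)
  θ-Lif k M = begin
    θ (Lif k M)                                 ≈⟨ θ-Σₛ M _ ⟩
    Σₛ M (λ m → θ (term k m))                   ≈⟨ Σₛ-cong M θ-term ⟩
    Σₛ M (λ m → B *ₛ (term k' m +ₛ -ₛ term k m)) ≈⟨ *ₛ-Σₛ B M _ ⟨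
    B *ₛ Σₛ M (λ m → term k' m +ₛ -ₛ term k m)   ≈⟨ *-cong ≈-refl (Σₛ-- M (term k') (term k)) ⟨
    B *ₛ (Lif k' M +ₛ -ₛ Lif k M)               ∎
    where
    k' = k ℤ.- ℤ.+ 1
    term : ℤ → ℕ → Ser
    term k m = const (lifCoeff k m) *ₛ ν ^ₛ m
    θ-term : ∀ m → θ (term k m) ≈ B *ₛ (term k' m +ₛ -ₛ term k m)
    θ-term m = begin
      θ (const c *ₛ ν ^ₛ m)                              ≈⟨ θ-const-* c (ν ^ₛ m) ⟩
      const c *ₛ θ (ν ^ₛ m)                              ≈⟨ *-cong ≈-refl (θ-^ₛ θ-ν m) ⟩
      const c *ₛ (const (ℕ→ℚ m) *ₛ ν ^ₛ m *ₛ B)          ≈⟨ regroup (const c) (const (ℕ→ℚ m)) (ν ^ₛ m) B ⟩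
      B *ₛ ((const c +ₛ const (ℕ→ℚ m) *ₛ const c) *ₛ ν ^ₛ m +ₛ -ₛ term k m)
        ≈⟨ *-cong ≈-refl (+-cong (*-cong coefficient ≈-refl) ≈-refl) ⟩
      B *ₛ (term k' m +ₛ -ₛ term k m)                    ∎
      where
      c = lifCoeff k m
      coefficient : const c +ₛ const (ℕ→ℚ m) *ₛ const c ≈ const (lifCoeff k' m)
      coefficient = ≈-trans (+-cong ≈-refl (≈-sym (const-* (ℕ→ℚ m) c)))
                    (≈-trans (≈-sym (const-+ c (ℕ→ℚ m * c))) (≈-reflexive (cong const (sym (lifCoeff-pred k m)))))
      regroup : ∀ c a p b → c *ₛ (a *ₛ p *ₛ b) ≈ b *ₛ ((c +ₛ a *ₛ c) *ₛ p +ₛ -ₛ (c *ₛ p))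
      regroup = solve 4 (λ c a p b → c :* (a :* p :* b) := b :* ((c :+ a :* c) :* p :+ :- (c :* p))) ≈-refl

  F : ℕ → ℤ → ℚ → ℕ → Ser
  F r k x M = B ^ₛ r *ₛ Lif k M *ₛ binom x

  θ-F : ∀ r k x M →
    θ (F r k x M) ≈ const x *ₛ (tₛ *ₛ F r k (x - 1ℚ) M)
                 +ₛ const (ℕ→ℚ r) *ₛ ((ℓ +ₛ -ₛ 1ₛ) *ₛ F (suc r) k x M)
                 +ₛ (F (suc r) (k ℤ.- ℤ.+ 1) x M +ₛ -ₛ F (suc r) k x M)
  θ-F r k x M = begin
    θ (Bʳ *ₛ L *ₛ X)                                           ≈⟨ θ-* (Bʳ *ₛ L) X ⟩
    θ (Bʳ *ₛ L) *ₛ X +ₛ Bʳ *ₛ L *ₛ θ X                          ≈⟨ +-cong (*-cong (θ-* Bʳ L) ≈-refl) ≈-refl ⟩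
    (θ Bʳ *ₛ L +ₛ Bʳ *ₛ θ L) *ₛ X +ₛ Bʳ *ₛ L *ₛ θ X
      ≈⟨ +-cong (*-cong (+-cong (*-cong (θ-^ₛ θ-B r) ≈-refl) (*-cong ≈-refl (θ-Lif k M))) ≈-refl)
                (*-cong ≈-refl (θ-binom x)) ⟩
    (const (ℕ→ℚ r) *ₛ Bʳ *ₛ (B *ₛ (ℓ +ₛ -ₛ 1ₛ)) *ₛ L +ₛ Bʳ *ₛ (B *ₛ (L' +ₛ -ₛ L))) *ₛ X
      +ₛ Bʳ *ₛ L *ₛ (const x *ₛ (tₛ *ₛ binom (x - 1ℚ)))
      ≈⟨ regroup (const (ℕ→ℚ r)) Bʳ B ℓ L L' X (binom (x - 1ℚ)) (const x) tₛ ⟩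
    _ ∎
    where
    Bʳ = B ^ₛ r; L = Lif k M; L' = Lif (k ℤ.- ℤ.+ 1) M; X = binom x
    regroup : ∀ cr Bʳ B l L L' X X' cx t →
      (cr *ₛ Bʳ *ₛ (B *ₛ (l +ₛ -ₛ 1ₛ)) *ₛ L +ₛ Bʳ *ₛ (B *ₛ (L' +ₛ -ₛ L))) *ₛ X +ₛ Bʳ *ₛ L *ₛ (cx *ₛ (t *ₛ X'))
      ≈ cx *ₛ (t *ₛ (Bʳ *ₛ L *ₛ X')) +ₛ cr *ₛ ((l +ₛ -ₛ 1ₛ) *ₛ (B *ₛ Bʳ *ₛ L *ₛ X))
        +ₛ (B *ₛ Bʳ *ₛ L' *ₛ X +ₛ -ₛ (B *ₛ Bʳ *ₛ L *ₛ X))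
    regroup = solve 10 (λ cr Bʳ B l L L' X X' cx t →
      (cr :* Bʳ :* (B :* (l :+ :- con 1ℚ)) :* L :+ Bʳ :* (B :* (L' :+ :- L))) :* X :+ Bʳ :* L :* (cx :* (t :* X'))
      := cx :* (t :* (Bʳ :* L :* X')) :+ cr :* ((l :+ :- con 1ℚ) :* (B :* Bʳ :* L :* X))
        :+ (B :* Bʳ :* L' :* X :+ :- (B :* Bʳ :* L :* X))) ≈-refl

open DifferentialEquation

module CoefficientExtraction where

  open ≡-Reasoning

  -- The truncation Lif k M has the coefficients of lifS k up to degree M, since
  -- (-log(1+t))ᵐ only contributes from degree m on.
  Lif-coef : ∀ k M i → i ≤ M → coef (Lif k M) i ≡ lifS k i
  Lif-coef k M i i≤M = begin
    Σ≤ M (λ m → coef (const (lifCoeff k m) *ₛ ν ^ₛ m) i)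
      ≡⟨ Σ-cong M (λ m → trans (const-*ₛ (lifCoeff k m) (ν ^ₛ m) i)
                               (cong (lifCoeff k m *_) (sym (at (powS-^ₛ negLog m) i)))) ⟩
    Σ≤ M (λ m → lifCoeff k m * powS negLog m i)
      ≡⟨ cong (λ b → Σ≤ b (λ m → lifCoeff k m * powS negLog m i)) (sym (ℕP.m+[n∸m]≡n i≤M)) ⟩
    Σ≤ (i ℕ.+ (M ∸ i)) (λ m → lifCoeff k m * powS negLog m i)
      ≡⟨ Σ-truncate i (M ∸ i) _ (λ m i<m → trans (cong (lifCoeff k m *_) (powS-vanish negLog refl m i i<m))
                                                 (ℚP.*-zeroʳ (lifCoeff k m))) ⟩
    lifS k i ∎

  -- [tⁿ] B^r · Lif_k(-log(1+t)) · (1+t)^x, so that Ã_n^{(r,k)}(x) = n! · G r k x n.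
  G : ℕ → ℤ → ℚ → ℕ → ℚ
  G r k x n = (powS baseS r ⊛ lifS k ⊛ binomS x) n

  F-coef : ∀ r k x M n → n ≤ M → coef (F r k x M) n ≡ G r k x n
  F-coef r k x M n n≤M = ⊛-cong≤ n {g = binomS x} {g' = binomS x}
    (λ i i≤n → ⊛-cong≤ i (λ j _ → sym (at (powS-^ₛ baseS r) j))
                         (λ j j≤i → Lif-coef k M j (ℕP.≤-trans j≤i (ℕP.≤-trans i≤n n≤M))))
    (λ i _ → refl)

  coef-tₛ* : ∀ a m → coef (tₛ *ₛ a) (suc m) ≡ coef a m
  coef-tₛ* a m = at (tₛ-*ₛ (coef a)) (suc m)

  G-recurrence : ∀ r k x m →
    ℕ→ℚ (suc m) * G r k x (suc m) ≡
      x * G r k (x - 1ℚ) m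
      + ℕ→ℚ r * Σ≤ m (λ a → logOverT (suc a) * G (suc r) k x (m ∸ a))
      + (G (suc r) (k ℤ.- ℤ.+ 1) x (suc m) - G (suc r) k x (suc m))
  G-recurrence r k x m = begin
    ℕ→ℚ (suc m) * G r k x (suc m)
      ≡⟨ cong (ℕ→ℚ (suc m) *_) (F-coef r k x M (suc m) ℕP.≤-refl) ⟨
    coef (θ (F r k x M)) (suc m)
      ≡⟨ at (θ-F r k x M) (suc m) ⟩
    coef (const x *ₛ (tₛ *ₛ F r k (x - 1ℚ) M)) (suc m)
      + coef (const (ℕ→ℚ r) *ₛ ((ℓ +ₛ -ₛ 1ₛ) *ₛ F (suc r) k x M)) (suc m)
      + (coef (F (suc r) (k ℤ.- ℤ.+ 1) x M) (suc m) - coef (F (suc r) k x M) (suc m))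
      ≡⟨ cong₂ _+_ (cong₂ _+_ shifted-term logarithmic-term)
                   (cong₂ _-_ (F-coef (suc r) (k ℤ.- ℤ.+ 1) x M (suc m) ℕP.≤-refl)
                              (F-coef (suc r) k x M (suc m) ℕP.≤-refl)) ⟩
    x * G r k (x - 1ℚ) m
      + ℕ→ℚ r * Σ≤ m (λ a → logOverT (suc a) * G (suc r) k x (m ∸ a))
      + (G (suc r) (k ℤ.- ℤ.+ 1) x (suc m) - G (suc r) k x (suc m)) ∎
    where
    M = suc m
    shifted-term : coef (const x *ₛ (tₛ *ₛ F r k (x - 1ℚ) M)) (suc m) ≡ x * G r k (x - 1ℚ) m
    shifted-term = trans (const-*ₛ x (tₛ *ₛ F r k (x - 1ℚ) M) (suc m))
      (cong (x *_) (trans (coef-tₛ* (F r k (x - 1ℚ) M) m) (F-coef r k (x - 1ℚ) M m (ℕP.n≤1+n m))))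
    -- ℓ - 1 = t·Σ_a [t^{a+1}]ℓ · tᵃ turns the product into a convolution of degree m
    logarithmic-term : coef (const (ℕ→ℚ r) *ₛ ((ℓ +ₛ -ₛ 1ₛ) *ₛ F (suc r) k x M)) (suc m)
                       ≡ ℕ→ℚ r * Σ≤ m (λ a → logOverT (suc a) * G (suc r) k x (m ∸ a))
    logarithmic-term = trans (const-*ₛ (ℕ→ℚ r) ((ℓ +ₛ -ₛ 1ₛ) *ₛ F (suc r) k x M) (suc m)) (cong (ℕ→ℚ r *_) (begin
      coef ((ℓ +ₛ -ₛ 1ₛ) *ₛ F (suc r) k x M) (suc m)
        ≡⟨ at (≈-trans (*-cong ℓ-1≈ ≈-refl) (*-assoc tₛ ℓ-tail (F (suc r) k x M))) (suc m) ⟩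
      coef (tₛ *ₛ (ℓ-tail *ₛ F (suc r) k x M)) (suc m)
        ≡⟨ coef-tₛ* (ℓ-tail *ₛ F (suc r) k x M) m ⟩
      Σ≤ m (λ a → logOverT (suc a) * coef (F (suc r) k x M) (m ∸ a))
        ≡⟨ Σ-cong≤ m (λ a a≤m → cong (logOverT (suc a) *_)
                     (F-coef (suc r) k x M (m ∸ a) (ℕP.≤-trans (ℕP.m∸n≤m m a) (ℕP.n≤1+n m)))) ⟩
      Σ≤ m (λ a → logOverT (suc a) * G (suc r) k x (m ∸ a)) ∎))

  binomial-convolution : ∀ m (g : ℕ → ℚ) →
    ℕ→ℚ (m !) * Σ≤ m (λ a → logOverT (suc a) * g (m ∸ a))
    ≡ Σ≤ m (λ a → sgn (suc a) * ℕ→ℚ (a !) * recipSuc (suc a) * ℕ→ℚ (m C a) * (ℕ→ℚ ((m ∸ a) !) * g (m ∸ a)))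
  binomial-convolution m g = trans (Σ-*ˡ m (ℕ→ℚ (m !)) _) (Σ-cong≤ m term)
    where
    term : ∀ a → a ≤ m → ℕ→ℚ (m !) * (logOverT (suc a) * g (m ∸ a)) ≡
           sgn (suc a) * ℕ→ℚ (a !) * recipSuc (suc a) * ℕ→ℚ (m C a) * (ℕ→ℚ ((m ∸ a) !) * g (m ∸ a))
    term a a≤m = begin
      ℕ→ℚ (m !) * (logOverT (suc a) * g (m ∸ a))
        ≡⟨ cong (λ u → ℕ→ℚ u * (logOverT (suc a) * g (m ∸ a))) (sym (factorial-binomial a≤m)) ⟩
      ℕ→ℚ (a ! ℕ.* (m C a) ℕ.* (m ∸ a) !) * (logOverT (suc a) * g (m ∸ a))
        ≡⟨ cong (_* (logOverT (suc a) * g (m ∸ a)))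
                (trans (ℕ→ℚ-* (a ! ℕ.* (m C a)) ((m ∸ a) !)) (cong (_* ℕ→ℚ ((m ∸ a) !)) (ℕ→ℚ-* (a !) (m C a)))) ⟩
      ℕ→ℚ (a !) * ℕ→ℚ (m C a) * ℕ→ℚ ((m ∸ a) !) * (sgn (suc a) * recipSuc (suc a) * g (m ∸ a))
        ≡⟨ regroup (ℕ→ℚ (a !)) (ℕ→ℚ (m C a)) (ℕ→ℚ ((m ∸ a) !)) (sgn (suc a)) (recipSuc (suc a)) (g (m ∸ a)) ⟩
      sgn (suc a) * ℕ→ℚ (a !) * recipSuc (suc a) * ℕ→ℚ (m C a) * (ℕ→ℚ ((m ∸ a) !) * g (m ∸ a)) ∎
      where
      regroup : ∀ A C D s r q → A * C * D * (s * r * q) ≡ s * A * r * C * (D * q)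
      regroup = solve-∀ ℚ-ring

open CoefficientExtraction

open ≡-Reasoning

-- For n = m+1: Ã_n = m!·(m+1)·G_n; insert G-recurrence and distribute m!,
-- which turns the convolution into the binomial sum and m!·(…) into
-- (1/n)·n!·(…).
theorem5 : (r : ℕ) → 1 ≤ r → (k : ℤ) → (n : ℕ) → .{{_ : NonZero n}} → (x : ℚ) →
    Atilde r k n x ≡
      x * Atilde r k (n ∸ 1) (x - 1ℚ)
      + ℕ→ℚ r * Σ≤ (n ∸ 1) (λ a → sgn (suc a) * ℕ→ℚ (a !) * recipSuc (suc a)
                                   * ℕ→ℚ ((n ∸ 1) C a) * Atilde (suc r) k (n ∸ 1 ∸ a) x)
      + (ℤ.+ 1 / n) * (Atilde (suc r) (k ℤ.- ℤ.+ 1) n x - Atilde (suc r) k n x)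
theorem5 r _ k (suc m) x = begin
  ℕ→ℚ (suc m !) * g                      ≡⟨ cong (_* g) (ℕ→ℚ-* (suc m) (m !)) ⟩
  ℕ→ℚ (suc m) * M * g                    ≡⟨ regroup (ℕ→ℚ (suc m)) M g ⟩
  M * (ℕ→ℚ (suc m) * g)                  ≡⟨ cong (M *_) (G-recurrence r k x m) ⟩
  M * (x * g₋ + ρ * S + (g₃ - g₂))        ≡⟨ distribute M x g₋ ρ S (g₃ - g₂) ⟩
  x * (M * g₋) + ρ * (M * S) + M * (g₃ - g₂)
    ≡⟨ cong₂ _+_ (cong (λ u → x * (M * g₋) + ρ * u) (binomial-convolution m (G (suc r) k x)))
                 (trans (cong (_* (g₃ - g₂)) (sym (recipSuc-factorial m)))
                        (distribute₂ (recipSuc m) (ℕ→ℚ (suc m !)) g₃ g₂)) ⟩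
  x * (M * g₋)
    + ρ * Σ≤ m (λ a → sgn (suc a) * ℕ→ℚ (a !) * recipSuc (suc a) * ℕ→ℚ (m C a)
                      * (ℕ→ℚ ((m ∸ a) !) * G (suc r) k x (m ∸ a)))
    + recipSuc m * (ℕ→ℚ (suc m !) * g₃ - ℕ→ℚ (suc m !) * g₂) ∎
  where
  M = ℕ→ℚ (m !); ρ = ℕ→ℚ r
  g = G r k x (suc m); g₋ = G r k (x - 1ℚ) m
  g₂ = G (suc r) k x (suc m); g₃ = G (suc r) (k ℤ.- ℤ.+ 1) x (suc m)
  S = Σ≤ m (λ a → logOverT (suc a) * G (suc r) k x (m ∸ a))
  regroup : ∀ s M g → s * M * g ≡ M * (s * g)
  regroup = solve-∀ ℚ-ring
  distribute : ∀ M x u ρ S v → M * (x * u + ρ * S + v) ≡ x * (M * u) + ρ * (M * S) + M * v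
  distribute = solve-∀ ℚ-ring
  distribute₂ : ∀ c P a b → c * P * (a - b) ≡ c * (P * a - P * b)
  distribute₂ = solve-∀ ℚ-ring
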